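{- Let $q\ge 2$, let $A$ be an alphabet with $q$ letters, and let $R_m$ denote the number of rich words of length $m$ over $A$. Let $c>1$ be a constant such that for every rich word over $A$ of length $n\ge 2$ the number of palindromes in its UPS-factorization is at most $c\frac{n}{\ln n}$, and put $\kappa_n=\lceil c\frac{n}{\ln n}\rceil$. Then for every $n\ge 2$, $$R_n\le \sum_{p=1}^{\kappa_n}\ \sum_{\substack{n_1+n_2+\dots+n_p=n\\ n_1,\dots,n_p\ge 1}} R_{\lceil n_1/2\rceil}R_{\lceil n_2/2\rceil}\cdots R_{\lceil n_p/2\rceil}.$$
   Context: A finite word $u=u_1\cdots u_n$ is a palindrome if $u_1\cdots u_n=u_n\cdots u_1$; the empty word is a palindrome. A word of length $n$ is rich if it has exactly $n+1$ distinct palindromic factors (including the empty word). For a rich word $w$, its UPS-factorization is the factorization $w=w_pw_{p-1}\cdots w_1$ into non-empty palindromes such that, for each $i$, $w_i$ is the longest palindromic suffix of $w_pw_{p-1}\cdots w_i$; it exists for every rich word. A constant $c>1$ with the stated property exists (depending on $q$). -}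

module Defs where

open import Data.Nat using (ℕ; zero; suc; _+_; _*_; _∸_; _≤_; ⌈_/2⌉)
open import Data.Nat.Properties using () renaming (_≟_ to _≟ℕ_)
open import Data.Fin using (Fin) renaming (_≟_ to _≟F_)
open import Data.List using (List; []; _∷_; _++_; [_]; length; reverse; map; concat; concatMap; filter; inits; tails; deduplicate; allFin; upTo)
open import Data.Nat.ListAction using (sum; product)
open import Data.List.Properties using (≡-dec)
open import Data.Product using (Σ; ∃; _×_; _,_)
open import Relation.Binary.PropositionalEquality using (_≡_)
open import Relation.Nullary using (Dec; ¬_)

Word : ℕ → Set
Word q = List (Fin q)

_≟W_ : ∀ {q} (u v : Word q) → Dec (u ≡ v)
_≟W_ = ≡-dec _≟F_

IsPalindrome : ∀ {q} → Word q → Set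
IsPalindrome u = reverse u ≡ u

isPalindrome? : ∀ {q} (u : Word q) → Dec (IsPalindrome u)
isPalindrome? u = reverse u ≟W u

factors : ∀ {q} → Word q → List (Word q)
factors w = concatMap inits (tails w)

distinctPalFactors : ∀ {q} → Word q → List (Word q)
distinctPalFactors w = deduplicate _≟W_ (filter isPalindrome? (factors w))

IsRich : ∀ {q} → Word q → Set
IsRich w = length (distinctPalFactors w) ≡ suc (length w)

isRich? : ∀ {q} (w : Word q) → Dec (IsRich w)
isRich? w = length (distinctPalFactors w) ≟ℕ suc (length w)

allWords : (q m : ℕ) → List (Word q)
allWords q zero = [] ∷ []
allWords q (suc m) = concatMap (λ a → map (a ∷_) (allWords q m)) (allFin q)

R : (q m : ℕ) → ℕ
R q m = length (filter isRich? (allWords q m))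

IsSuffix : ∀ {q} → Word q → Word q → Set
IsSuffix s u = ∃ λ t → t ++ s ≡ u

IsLongestPalSuffix : ∀ {q} → Word q → Word q → Set
IsLongestPalSuffix s u =
  IsSuffix s u × IsPalindrome s ×
  (∀ s′ → IsSuffix s′ u → IsPalindrome s′ → length s′ ≤ length s)

-- fs = [w_p , w_{p-1} , … , w_1] is the UPS-factorization of w:
-- w = w_p w_{p-1} ⋯ w_1, each w_i a non-empty palindrome, and each w_i is
-- the longest palindromic suffix of w_p ⋯ w_i.
IsUPSFactorization : ∀ {q} → List (Word q) → Word q → Set
IsUPSFactorization fs w =
  concat fs ≡ w ×
  (∀ pre x post → fs ≡ pre ++ x ∷ post →
     ¬ (x ≡ []) × IsPalindrome x × IsLongestPalSuffix x (concat pre ++ x))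

compositions : ℕ → ℕ → List (List ℕ)
compositions zero zero = [] ∷ []
compositions zero (suc n) = []
compositions (suc p) n =
  concatMap (λ k → map (suc k ∷_) (compositions p (n ∸ suc k))) (upTo n)

innerSum : (q p n : ℕ) → ℕ
innerSum q p n = sum (map (λ ns → product (map (λ k → R q ⌈ k /2⌉) ns)) (compositions p n))

outerSum : (q K n : ℕ) → ℕ
outerSum q K n = sum (map (λ i → innerSum q (suc i) n) (upTo K))

-- Each piece of the UPS-factorization of w is a palindrome, hence determined by its
-- length n_i and its first half, of length ⌈n_i/2⌉, which is a factor of w. Factors
-- of rich words are rich: extending a word by one letter (on either side) creates at
-- most one new palindromic factor, so a factor misses no more of its possible
-- palindromes than the whole word does. Thus a rich word of length n is recovered
-- from a composition (n_1,…,n_p) of n with p ≤ κ_n and rich words of lengths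
-- ⌈n_i/2⌉, and the sum in the statement counts exactly these codes.
module Submission where

open import Defs
open import Data.Nat using (ℕ; zero; suc; _+_; _*_; _∸_; _≤_; _<_; z≤n; s≤s; ⌈_/2⌉; ⌊_/2⌋; _⊓_)
open import Data.Nat.Properties
open import Data.List using (List; []; _∷_; _++_; [_]; length; reverse; map; concat; concatMap; filter; inits; tails; allFin; upTo; take; drop; _∷ʳ_; zipWith; initLast; _∷ʳ′_)
open import Data.List.Properties
open import Data.Nat.ListAction using (sum; product)
open import Data.List.Membership.Propositional using (_∈_; lose; find)
open import Data.List.Membership.Propositional.Properties
open import Data.List.Relation.Binary.Subset.Propositional using (_⊆_)
open import Data.List.Relation.Unary.Any using (here; there)
open import Data.List.Relation.Unary.All as All using (All; []; _∷_)
import Data.List.Relation.Unary.All.Properties as All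
open import Data.List.Relation.Unary.AllPairs using ([]; _∷_)
open import Data.List.Relation.Unary.Unique.Propositional using (Unique)
import Data.List.Relation.Unary.Unique.Propositional.Properties as Unique
open import Data.List.Relation.Unary.Unique.DecPropositional.Properties using (deduplicate-!)
open import Data.Product using (∃; ∃₂; _×_; _,_; proj₁; proj₂)
import Data.Product as Product
open import Data.Sum using (_⊎_; inj₁; inj₂)
import Data.Sum as Sum
open import Data.Empty using (⊥-elim)
open import Function using (_∘_)
open import Relation.Binary.PropositionalEquality hiding ([_])
open import Relation.Nullary using (yes; no; ¬_)

module _ {A : Set} where

  Unique-⊆⇒length≤ : ∀ {xs ys : List A} → Unique xs → xs ⊆ ys → length xs ≤ length ys
  Unique-⊆⇒length≤ {[]} _ _ = z≤n
  Unique-⊆⇒length≤ {x ∷ xs} (x∉xs ∷ xs!) xs⊆ys with ∈-∃++ (xs⊆ys (here refl))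
  ... | ys₁ , ys₂ , refl =
    ≤-trans (s≤s (Unique-⊆⇒length≤ xs! xs⊆ys₁ys₂)) (≤-reflexive (sym (length-++-sucʳ ys₁ x ys₂)))
    where
    xs⊆ys₁ys₂ : xs ⊆ ys₁ ++ ys₂
    xs⊆ys₁ys₂ {z} z∈xs with ∈-++⁻ ys₁ (xs⊆ys (there z∈xs))
    ... | inj₁ z∈ys₁ = ∈-++⁺ˡ z∈ys₁
    ... | inj₂ (here z≡x) = ⊥-elim (All.lookup x∉xs z∈xs (sym z≡x))
    ... | inj₂ (there z∈ys₂) = ∈-++⁺ʳ ys₁ z∈ys₂

  length-concatMap : ∀ {B : Set} (f : A → List B) xs →
                     length (concatMap f xs) ≡ sum (map (length ∘ f) xs)
  length-concatMap f [] = refl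
  length-concatMap f (x ∷ xs) = trans (length-++ (f x)) (cong (length (f x) +_) (length-concatMap f xs))

  length-concat : ∀ (xss : List (List A)) → length (concat xss) ≡ sum (map length xss)
  length-concat [] = refl
  length-concat (xs ∷ xss) = trans (length-++ xs) (cong (length xs +_) (length-concat xss))

  length-<-++ : ∀ (xs : List A) {ys} → ¬ ys ≡ [] → length xs < length (xs ++ ys)
  length-<-++ xs {[]} ys≢[] = ⊥-elim (ys≢[] refl)
  length-<-++ xs {y ∷ ys} _ = ≤-trans (s≤s (length-++-≤ˡ xs)) (≤-reflexive (sym (length-++-sucʳ xs y ys)))

  take-length-++ : ∀ (xs ys : List A) → take (length xs) (xs ++ ys) ≡ xs
  take-length-++ [] ys = refl
  take-length-++ (x ∷ xs) ys = cong (x ∷_) (take-length-++ xs ys)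

  suffix-of-longer-suffix : ∀ (x s u L : List A) → x ++ s ≡ u ++ L → length s ≤ length L →
                            ∃ λ t → t ++ s ≡ L
  suffix-of-longer-suffix x s [] L eq _ = x , eq
  suffix-of-longer-suffix [] s (c ∷ u) L refl |s|≤|L| =
    ⊥-elim (<⇒≱ (s≤s (length-++-≤ʳ L {u})) |s|≤|L|)
  suffix-of-longer-suffix (_ ∷ x) s (_ ∷ u) L eq |s|≤|L| =
    suffix-of-longer-suffix x s u L (∷-injectiveʳ eq) |s|≤|L|

  prependEach : List A → List (List A) → List (List A)
  prependEach as xss = concatMap (λ a → map (a ∷_) xss) as

  length-prependEach : ∀ as xss → length (prependEach as xss) ≡ length as * length xss
  length-prependEach [] xss = refl
  length-prependEach (a ∷ as) xss =
    trans (length-++ (map (a ∷_) xss)) (cong₂ _+_ (length-map (a ∷_) xss) (length-prependEach as xss))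

  ∈-prependEach⁺ : ∀ {a as xs xss} → a ∈ as → xs ∈ xss → a ∷ xs ∈ prependEach as xss
  ∈-prependEach⁺ {a} a∈as xs∈xss = ∈-concatMap⁺ _ (lose a∈as (∈-map⁺ (a ∷_) xs∈xss))

  ∈-prependEach⁻ : ∀ {as xss ys} → ys ∈ prependEach as xss →
                   ∃₂ λ a xs → a ∈ as × xs ∈ xss × ys ≡ a ∷ xs
  ∈-prependEach⁻ {xss = xss} ys∈ with find (∈-concatMap⁻ (λ a → map (a ∷_) xss) ys∈)
  ... | a , a∈as , ys∈a∷xss with ∈-map⁻ (a ∷_) ys∈a∷xss
  ... | xs , xs∈xss , ys≡a∷xs = a , xs , a∈as , xs∈xss , ys≡a∷xs

  Unique-prependEach : ∀ {as xss} → Unique as → Unique xss → Unique (prependEach as xss)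
  Unique-prependEach {[]} _ _ = []
  Unique-prependEach {a ∷ as} {xss} (a∉as ∷ as!) xss! =
    Unique.++⁺ (Unique.map⁺ ∷-injectiveʳ xss!) (Unique-prependEach as! xss!) disjoint
    where
    disjoint : ∀ {ys} → ¬ (ys ∈ map (a ∷_) xss × ys ∈ prependEach as xss)
    disjoint (ys∈a∷xss , ys∈rest) with ∈-map⁻ (a ∷_) ys∈a∷xss | ∈-prependEach⁻ {as} {xss} ys∈rest
    ... | _ , _ , refl | b , _ , b∈as , _ , a∷xs≡b∷xs′ = All.lookup a∉as b∈as (∷-injectiveˡ a∷xs≡b∷xs′)

  allChoices : List (List A) → List (List A)
  allChoices [] = [ [] ]
  allChoices (as ∷ ass) = prependEach as (allChoices ass)

  length-allChoices : ∀ ass → length (allChoices ass) ≡ product (map length ass)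
  length-allChoices [] = refl
  length-allChoices (as ∷ ass) =
    trans (length-prependEach as (allChoices ass)) (cong (length as *_) (length-allChoices ass))

  ∈-allChoices-map : ∀ {B : Set} (f : B → A) (g : B → List A) xs →
                     All (λ x → f x ∈ g x) xs → map f xs ∈ allChoices (map g xs)
  ∈-allChoices-map f g [] [] = here refl
  ∈-allChoices-map f g (x ∷ xs) (fx∈gx ∷ rest) = ∈-prependEach⁺ fx∈gx (∈-allChoices-map f g xs rest)

  Factor : List A → List A → Set
  Factor s w = ∃₂ λ x y → x ++ s ++ y ≡ w

  Factor-trans : ∀ {s t w} → Factor s t → Factor t w → Factor s w
  Factor-trans {s} (x , y , refl) (x′ , y′ , refl) = x′ ++ x , y ++ y′ , (begin
      (x′ ++ x) ++ s ++ y ++ y′   ≡⟨ ++-assoc x′ x _ ⟩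
      x′ ++ x ++ s ++ y ++ y′     ≡⟨ cong (λ z → x′ ++ x ++ z) (sym (++-assoc s y y′)) ⟩
      x′ ++ x ++ (s ++ y) ++ y′   ≡⟨ cong (x′ ++_) (sym (++-assoc x (s ++ y) y′)) ⟩
      x′ ++ (x ++ s ++ y) ++ y′   ∎)
    where open ≡-Reasoning

  Factor-reverse : ∀ {s w} → Factor s w → Factor (reverse s) (reverse w)
  Factor-reverse {s} (x , y , refl) = reverse y , reverse x , (begin
      reverse y ++ reverse s ++ reverse x   ≡⟨ sym (++-assoc (reverse y) (reverse s) (reverse x)) ⟩
      (reverse y ++ reverse s) ++ reverse x ≡⟨ cong (_++ reverse x) (sym (reverse-++ s y)) ⟩
      reverse (s ++ y) ++ reverse x         ≡⟨ sym (reverse-++ x (s ++ y)) ⟩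
      reverse (x ++ s ++ y)                 ∎)
    where open ≡-Reasoning

  ∈-inits⁺ : ∀ (s y : List A) → s ∈ inits (s ++ y)
  ∈-inits⁺ [] [] = here refl
  ∈-inits⁺ [] (_ ∷ _) = here refl
  ∈-inits⁺ (a ∷ s) y = there (∈-map⁺ (a ∷_) (∈-inits⁺ s y))

  ∈-inits⁻ : ∀ {s : List A} t → s ∈ inits t → ∃ λ y → s ++ y ≡ t
  ∈-inits⁻ [] (here refl) = [] , refl
  ∈-inits⁻ (a ∷ t) (here refl) = a ∷ t , refl
  ∈-inits⁻ (a ∷ t) (there s∈) with ∈-map⁻ (a ∷_) s∈
  ... | s′ , s′∈ , refl = Product.map₂ (cong (a ∷_)) (∈-inits⁻ t s′∈)

  ∈-tails⁺ : ∀ (x t : List A) → t ∈ tails (x ++ t)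
  ∈-tails⁺ [] [] = here refl
  ∈-tails⁺ [] (_ ∷ _) = here refl
  ∈-tails⁺ (a ∷ x) t = there (∈-tails⁺ x t)

  ∈-tails⁻ : ∀ {t : List A} w → t ∈ tails w → ∃ λ x → x ++ t ≡ w
  ∈-tails⁻ [] (here refl) = [] , refl
  ∈-tails⁻ (a ∷ w) (here refl) = [] , refl
  ∈-tails⁻ (a ∷ w) (there t∈) = Product.map (a ∷_) (cong (a ∷_)) (∈-tails⁻ w t∈)

∈-compositions : ∀ ns → All (1 ≤_) ns → ns ∈ compositions (length ns) (sum ns)
∈-compositions [] [] = here refl
∈-compositions (suc k ∷ ns) (_ ∷ ns≥1) =
  ∈-concatMap⁺ _ (lose (∈-upTo⁺ (s≤s (m≤m+n k (sum ns))))
    (∈-map⁺ (suc k ∷_) (subst (λ m → ns ∈ compositions (length ns) m) (sym (m+n∸m≡n (suc k) (sum ns)))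
      (∈-compositions ns ns≥1))))

module _ {q : ℕ} where

  Factor⇒∈factors : ∀ {s w : Word q} → Factor s w → s ∈ factors w
  Factor⇒∈factors {s} (x , y , refl) = ∈-concatMap⁺ inits (lose (∈-tails⁺ x (s ++ y)) (∈-inits⁺ s y))

  ∈factors⇒Factor : ∀ {s : Word q} w → s ∈ factors w → Factor s w
  ∈factors⇒Factor w s∈ with find (∈-concatMap⁻ inits {xs = tails w} s∈)
  ... | t , t∈tails , s∈inits with ∈-tails⁻ w t∈tails | ∈-inits⁻ t s∈inits
  ... | x , refl | y , refl = x , y , refl

  palindrome-suffix⇒prefix : ∀ {L s t : Word q} → IsPalindrome L → IsPalindrome s →
                             t ++ s ≡ L → s ++ reverse t ≡ L
  palindrome-suffix⇒prefix {L} {s} {t} L-pal s-pal t++s≡L = begin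
      s ++ reverse t          ≡⟨ cong (_++ reverse t) (sym s-pal) ⟩
      reverse s ++ reverse t  ≡⟨ sym (reverse-++ t s) ⟩
      reverse (t ++ s)        ≡⟨ cong reverse t++s≡L ⟩
      reverse L               ≡⟨ L-pal ⟩
      L                       ∎
    where open ≡-Reasoning

  PalFactor : Word q → Word q → Set
  PalFactor s w = IsPalindrome s × Factor s w

  ∈-distinctPalFactors⁺ : ∀ {s w : Word q} → PalFactor s w → s ∈ distinctPalFactors w
  ∈-distinctPalFactors⁺ (s-pal , s⊑w) =
    ∈-deduplicate⁺ _≟W_ (∈-filter⁺ isPalindrome? (Factor⇒∈factors s⊑w) s-pal)

  ∈-distinctPalFactors⁻ : ∀ {s : Word q} w → s ∈ distinctPalFactors w → PalFactor s w
  ∈-distinctPalFactors⁻ w s∈ with ∈-filter⁻ isPalindrome? (∈-deduplicate⁻ _≟W_ _ s∈)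
  ... | s∈factors , s-pal = s-pal , ∈factors⇒Factor w s∈factors

  palCount : Word q → ℕ
  palCount w = length (distinctPalFactors w)

  palCount-≤-suc : ∀ {v w z : Word q} → (∀ {s} → PalFactor s v → PalFactor s w ⊎ s ≡ z) →
                   palCount v ≤ suc (palCount w)
  palCount-≤-suc {v} {w} {z} old-or-z =
    Unique-⊆⇒length≤ (deduplicate-! _≟W_ (filter isPalindrome? (factors v))) ⊆z∷
    where
    ⊆z∷ : distinctPalFactors v ⊆ z ∷ distinctPalFactors w
    ⊆z∷ s∈ with old-or-z (∈-distinctPalFactors⁻ v s∈)
    ... | inj₁ s-palFactor = there (∈-distinctPalFactors⁺ s-palFactor)
    ... | inj₂ refl = here refl

  longestPalSuffix : Word q → Word q
  longestPalSuffix [] = []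
  longestPalSuffix (a ∷ t) with isPalindrome? (a ∷ t)
  ... | yes _ = a ∷ t
  ... | no _ = longestPalSuffix t

  longestPalSuffix-correct : ∀ w → IsLongestPalSuffix (longestPalSuffix w) w
  longestPalSuffix-correct [] = ([] , refl) , refl , λ { _ ([] , refl) _ → z≤n }
  longestPalSuffix-correct (a ∷ t) with isPalindrome? (a ∷ t)
  ... | yes a∷t-pal = ([] , refl) , a∷t-pal ,
        λ s (u , u++s≡) _ → ≤-trans (length-++-≤ʳ s {u}) (≤-reflexive (cong length u++s≡))
  ... | no ¬a∷t-pal with longestPalSuffix-correct t
  ...   | (u , u++L≡t) , L-pal , L-longest = (a ∷ u , cong (a ∷_) u++L≡t) , L-pal , longest
    where
    longest : ∀ s → IsSuffix s (a ∷ t) → IsPalindrome s → length s ≤ length (longestPalSuffix t)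
    longest s ([] , refl) s-pal = ⊥-elim (¬a∷t-pal s-pal)
    longest s (_ ∷ u′ , eq) s-pal = L-longest s (u′ , ∷-injectiveʳ eq) s-pal

  longestPalSuffix-≢[] : ∀ a t → ¬ longestPalSuffix (a ∷ t) ≡ []
  longestPalSuffix-≢[] a t with isPalindrome? (a ∷ t)
  ... | yes _ = λ ()
  longestPalSuffix-≢[] a [] | no ¬pal = ⊥-elim (¬pal refl)
  longestPalSuffix-≢[] a (b ∷ t) | no _ = longestPalSuffix-≢[] b t

  -- A palindromic suffix shorter than the longest one L is reflected inside L, and
  -- thus already occurs before the last letter.
  palSuffix-∷ʳ : ∀ (w : Word q) a {s} → IsPalindrome s → IsSuffix s (w ∷ʳ a) →
                 PalFactor s w ⊎ s ≡ longestPalSuffix (w ∷ʳ a)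
  palSuffix-∷ʳ w a {s} s-pal (x , x++s≡) with longestPalSuffix-correct (w ∷ʳ a)
  ... | (u , u++L≡) , L-pal , L-longest
      with suffix-of-longer-suffix x s u _ (trans x++s≡ (sym u++L≡)) (L-longest s (x , x++s≡) s-pal)
  ...   | [] , refl = inj₂ refl
  ...   | c ∷ t , c∷t++s≡L = inj₁ (s-pal , u , reverse t , ∷ʳ-injectiveˡ (u ++ s ++ reverse t) w (begin
      (u ++ s ++ reverse t) ∷ʳ c   ≡⟨ ++-assoc u (s ++ reverse t) [ c ] ⟩
      u ++ (s ++ reverse t) ∷ʳ c   ≡⟨ cong (u ++_) (++-assoc s (reverse t) [ c ]) ⟩
      u ++ s ++ reverse t ∷ʳ c     ≡⟨ cong (λ z → u ++ s ++ z) (sym (unfold-reverse c t)) ⟩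
      u ++ s ++ reverse (c ∷ t)    ≡⟨ cong (u ++_) (palindrome-suffix⇒prefix L-pal s-pal c∷t++s≡L) ⟩
      u ++ longestPalSuffix (w ∷ʳ a) ≡⟨ u++L≡ ⟩
      w ∷ʳ a                       ∎))
    where open ≡-Reasoning

  palFactor-∷ʳ : ∀ (w : Word q) a {s} → PalFactor s (w ∷ʳ a) →
                 PalFactor s w ⊎ s ≡ longestPalSuffix (w ∷ʳ a)
  palFactor-∷ʳ w a {s} (s-pal , x , y , eq) with initLast y
  ... | [] = palSuffix-∷ʳ w a s-pal (x , trans (cong (x ++_) (sym (++-identityʳ s))) eq)
  ... | y′ ∷ʳ′ b = inj₁ (s-pal , x , y′ , ∷ʳ-injectiveˡ (x ++ s ++ y′) w (begin
      (x ++ s ++ y′) ∷ʳ b  ≡⟨ ++-assoc x (s ++ y′) [ b ] ⟩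
      x ++ (s ++ y′) ∷ʳ b  ≡⟨ cong (x ++_) (++-assoc s y′ [ b ]) ⟩
      x ++ s ++ y′ ∷ʳ b    ≡⟨ eq ⟩
      w ∷ʳ a               ∎))
    where open ≡-Reasoning

  palFactor-∷ : ∀ (w : Word q) a {s} → PalFactor s (a ∷ w) →
                PalFactor s w ⊎ s ≡ longestPalSuffix (reverse w ∷ʳ a)
  palFactor-∷ w a {s} (s-pal , s⊑a∷w) =
    Sum.map₁ (λ (_ , s⊑rev) → s-pal , subst₂ Factor s-pal (reverse-involutive w) (Factor-reverse s⊑rev))
      (palFactor-∷ʳ (reverse w) a (s-pal , subst₂ Factor s-pal (unfold-reverse a w) (Factor-reverse s⊑a∷w)))

  palCount-++ʳ : ∀ (u y : Word q) → palCount (u ++ y) ≤ palCount u + length y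
  palCount-++ʳ u [] = ≤-reflexive (trans (cong palCount (++-identityʳ u)) (sym (+-identityʳ (palCount u))))
  palCount-++ʳ u (b ∷ y) = begin
      palCount (u ++ b ∷ y)               ≡⟨ cong palCount (sym (++-assoc u [ b ] y)) ⟩
      palCount ((u ∷ʳ b) ++ y)            ≤⟨ palCount-++ʳ (u ∷ʳ b) y ⟩
      palCount (u ∷ʳ b) + length y        ≤⟨ +-monoˡ-≤ (length y) (palCount-≤-suc (palFactor-∷ʳ u b)) ⟩
      suc (palCount u) + length y         ≡⟨ sym (+-suc (palCount u) (length y)) ⟩
      palCount u + length (b ∷ y)         ∎
    where open ≤-Reasoning

  palCount-++ˡ : ∀ (x v : Word q) → palCount (x ++ v) ≤ length x + palCount v
  palCount-++ˡ [] v = ≤-refl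
  palCount-++ˡ (a ∷ x) v =
    ≤-trans (palCount-≤-suc (palFactor-∷ (x ++ v) a)) (s≤s (palCount-++ˡ x v))

  palCount≤suc-length : ∀ (w : Word q) → palCount w ≤ suc (length w)
  palCount≤suc-length w = palCount-++ʳ [] w

  length-++-++ : ∀ (x s y : Word q) → length (x ++ s ++ y) ≡ length x + (length s + length y)
  length-++-++ x s y = trans (length-++ x) (cong (length x +_) (length-++ s))

  IsRich-Factor : ∀ {s w : Word q} → IsRich w → Factor s w → IsRich s
  IsRich-Factor {s} w-rich (x , y , refl) = ≤-antisym (palCount≤suc-length s)
    (+-cancelʳ-≤ (length y) _ _ (+-cancelˡ-≤ (length x) _ _ (begin
      length x + (suc (length s) + length y) ≡⟨ +-suc (length x) (length s + length y) ⟩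
      suc (length x + (length s + length y)) ≡⟨ cong suc (sym (length-++-++ x s y)) ⟩
      suc (length (x ++ s ++ y))             ≡⟨ sym w-rich ⟩
      palCount (x ++ s ++ y)                 ≤⟨ palCount-++ˡ x (s ++ y) ⟩
      length x + palCount (s ++ y)           ≤⟨ +-monoʳ-≤ (length x) (palCount-++ʳ s y) ⟩
      length x + (palCount s + length y)     ∎)))
    where open ≤-Reasoning

  IsUPSFactorization-∷ʳ : ∀ {u L : Word q} {pieces : List (Word q)} → IsUPSFactorization pieces u →
                          ¬ L ≡ [] → IsLongestPalSuffix L (u ++ L) → IsUPSFactorization (pieces ∷ʳ L) (u ++ L)
  IsUPSFactorization-∷ʳ {L = L} {pieces} (refl , pieces-ok) L≢[] L-longest = concat-∷ʳ , splits-ok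
    where
    concat-∷ʳ : concat (pieces ∷ʳ L) ≡ concat pieces ++ L
    concat-∷ʳ = trans (sym (concat-++ pieces [ L ])) (cong (concat pieces ++_) (++-identityʳ L))
    splits-ok : ∀ pre x post → pieces ∷ʳ L ≡ pre ++ x ∷ post →
              ¬ x ≡ [] × IsPalindrome x × IsLongestPalSuffix x (concat pre ++ x)
    splits-ok pre x post eq with initLast post
    ... | [] with ∷ʳ-injective pieces pre eq
    ...   | refl , refl = L≢[] , proj₁ (proj₂ L-longest) , L-longest
    splits-ok pre x post eq | ini ∷ʳ′ z =
      pieces-ok pre x ini (∷ʳ-injectiveˡ pieces (pre ++ x ∷ ini) (trans eq (sym (++-assoc pre (x ∷ ini) [ z ]))))

  upsFactorization : ∀ (w : Word q) → ∃ λ fs → IsUPSFactorization fs w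
  upsFactorization w = ups (length w) w ≤-refl
    where
    ups : ∀ n w → length w ≤ n → ∃ λ fs → IsUPSFactorization fs w
    ups _ [] _ = [] , refl , λ { [] _ _ () ; (_ ∷ _) _ _ () }
    ups (suc n) (a ∷ t) (s≤s |t|≤n) with longestPalSuffix-correct (a ∷ t)
    ... | (u , u++L≡) , L-pal , L-longest =
      let fs , fs-ups = ups n u |u|≤n
      in fs ∷ʳ L , subst (IsUPSFactorization (fs ∷ʳ L)) u++L≡
            (IsUPSFactorization-∷ʳ fs-ups L≢[]
              (subst (IsLongestPalSuffix L) (sym u++L≡) ((u , u++L≡) , L-pal , L-longest)))
      where
      L : Word q
      L = longestPalSuffix (a ∷ t)
      L≢[] : ¬ L ≡ []
      L≢[] = longestPalSuffix-≢[] a t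
      |u|≤n : length u ≤ n
      |u|≤n = ≤-pred (≤-trans (length-<-++ u L≢[]) (≤-trans (≤-reflexive (cong length u++L≡)) (s≤s |t|≤n)))

  half : Word q → Word q
  half x = take ⌈ length x /2⌉ x

  length-half : ∀ (x : Word q) → length (half x) ≡ ⌈ length x /2⌉
  length-half x = trans (length-take _ x) (m≤n⇒m⊓n≡m (⌈n/2⌉≤n (length x)))

  Factor-half : ∀ (x : Word q) → Factor (half x) x
  Factor-half x = [] , drop ⌈ length x /2⌉ x , take++drop≡id ⌈ length x /2⌉ x

  mirror : ℕ → Word q → Word q
  mirror k h = h ++ reverse (take ⌊ k /2⌋ h)

  mirror-half : ∀ (x : Word q) → IsPalindrome x → mirror (length x) (half x) ≡ x
  mirror-half x x-pal = trans (cong (take c x ++_) second-half) (take++drop≡id c x)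
    where
    k c f : ℕ
    k = length x
    c = ⌈ k /2⌉
    f = ⌊ k /2⌋
    open ≡-Reasoning
    f≡|rev-drop| : f ≡ length (reverse (drop c x))
    f≡|rev-drop| = sym (begin
      length (reverse (drop c x)) ≡⟨ length-reverse (drop c x) ⟩
      length (drop c x)           ≡⟨ length-drop c x ⟩
      k ∸ c                       ≡⟨ cong (_∸ c) (sym (⌊n/2⌋+⌈n/2⌉≡n k)) ⟩
      f + c ∸ c                   ≡⟨ m+n∸n≡m f c ⟩
      f                           ∎)
    take-f : take f x ≡ reverse (drop c x)
    take-f = begin
      take f x                                           ≡⟨ cong (take f) (sym x-pal) ⟩
      take f (reverse x)                                 ≡⟨ cong (take f ∘ reverse) (sym (take++drop≡id c x)) ⟩
      take f (reverse (take c x ++ drop c x))            ≡⟨ cong (take f) (reverse-++ (take c x) (drop c x)) ⟩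
      take f (reverse (drop c x) ++ reverse (take c x))
        ≡⟨ cong (λ n → take n (reverse (drop c x) ++ reverse (take c x))) f≡|rev-drop| ⟩
      take (length (reverse (drop c x))) (reverse (drop c x) ++ reverse (take c x))
        ≡⟨ take-length-++ _ _ ⟩
      reverse (drop c x)                                 ∎
    second-half : reverse (take f (take c x)) ≡ drop c x
    second-half = begin
      reverse (take f (take c x))  ≡⟨ cong reverse (take-take f c x) ⟩
      reverse (take (f ⊓ c) x)     ≡⟨ cong (λ n → reverse (take n x)) (m≤n⇒m⊓n≡m (⌊n/2⌋≤⌈n/2⌉ k)) ⟩
      reverse (take f x)           ≡⟨ cong reverse take-f ⟩
      reverse (reverse (drop c x)) ≡⟨ reverse-involutive (drop c x) ⟩
      drop c x                     ∎

  ∈-allWords : ∀ (w : Word q) → w ∈ allWords q (length w)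
  ∈-allWords [] = here refl
  ∈-allWords (a ∷ w) = ∈-prependEach⁺ (∈-allFin a) (∈-allWords w)

  ∈-allWords⇒length : ∀ m {w : Word q} → w ∈ allWords q m → length w ≡ m
  ∈-allWords⇒length zero (here refl) = refl
  ∈-allWords⇒length (suc m) w∈ with ∈-prependEach⁻ {as = allFin q} {xss = allWords q m} w∈
  ... | _ , _ , _ , v∈ , refl = cong suc (∈-allWords⇒length m v∈)

  allWords-Unique : ∀ m → Unique (allWords q m)
  allWords-Unique zero = [] ∷ []
  allWords-Unique (suc m) = Unique-prependEach (Unique.allFin⁺ q) (allWords-Unique m)

  richWords : ℕ → List (Word q)
  richWords m = filter isRich? (allWords q m)

  Code : Set
  Code = List ℕ × List (Word q)

  decode : Code → Word q
  decode (ns , hs) = concat (zipWith mirror ns hs)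

  encode : List (Word q) → Code
  encode fs = map length fs , map half fs

  richHalves : List ℕ → List (List (Word q))
  richHalves ns = allChoices (map (richWords ∘ ⌈_/2⌉) ns)

  length-richHalves : ∀ ns → length (richHalves ns) ≡ product (map (R q ∘ ⌈_/2⌉) ns)
  length-richHalves ns =
    trans (length-allChoices (map (richWords ∘ ⌈_/2⌉) ns)) (cong product (sym (map-∘ {g = length} ns)))

  codesOfLength : ℕ → ℕ → List Code
  codesOfLength p n = concatMap (λ ns → map (ns ,_) (richHalves ns)) (compositions p n)

  codes : ℕ → ℕ → List Code
  codes K n = concatMap (λ i → codesOfLength (suc i) n) (upTo K)

  length-codesOfLength : ∀ p n → length (codesOfLength p n) ≡ innerSum q p n
  length-codesOfLength p n =
    trans (length-concatMap _ (compositions p n)) (cong sum (map-cong count (compositions p n)))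
    where
    count : ∀ ns → length (map (ns ,_) (richHalves ns)) ≡ product (map (R q ∘ ⌈_/2⌉) ns)
    count ns = trans (length-map (ns ,_) (richHalves ns)) (length-richHalves ns)

  length-codes : ∀ K n → length (codes K n) ≡ outerSum q K n
  length-codes K n =
    trans (length-concatMap _ (upTo K)) (cong sum (map-cong (λ i → length-codesOfLength (suc i) n) (upTo K)))

  decode-encode : ∀ fs → All IsPalindrome fs → decode (encode fs) ≡ concat fs
  decode-encode [] [] = refl
  decode-encode (x ∷ fs) (x-pal ∷ fs-pal) = cong₂ _++_ (mirror-half x x-pal) (decode-encode fs fs-pal)

  encode-∈-codesOfLength : ∀ fs → All (λ x → 1 ≤ length x) fs → All (IsRich ∘ half) fs →
                           encode fs ∈ codesOfLength (length fs) (length (concat fs))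
  encode-∈-codesOfLength fs fs≥1 halves-rich =
    ∈-concatMap⁺ _ (lose lengths∈ (∈-map⁺ (map length fs ,_) halves∈))
    where
    lengths∈ : map length fs ∈ compositions (length fs) (length (concat fs))
    lengths∈ = subst₂ (λ p n → map length fs ∈ compositions p n) (length-map length fs) (sym (length-concat fs))
                 (∈-compositions (map length fs) (All.map⁺ fs≥1))
    half∈ : ∀ {x} → IsRich (half x) → half x ∈ richWords ⌈ length x /2⌉
    half∈ {x} rich =
      subst (λ m → half x ∈ richWords m) (length-half x) (∈-filter⁺ isRich? (∈-allWords (half x)) rich)
    halves∈ : map half fs ∈ richHalves (map length fs)
    halves∈ = subst (λ ass → map half fs ∈ allChoices ass) (map-∘ fs)
                (∈-allChoices-map half (richWords ∘ ⌈_/2⌉ ∘ length) fs (All.map half∈ halves-rich))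

  UPS-piece : ∀ {fs : List (Word q)} {w} → IsUPSFactorization fs w → ∀ {x} → x ∈ fs →
              1 ≤ length x × PalFactor x w
  UPS-piece (refl , pieces-ok) x∈ with ∈-∃++ x∈
  ... | pre , post , refl with pieces-ok pre _ post refl
  ...   | x≢[] , x-pal , _ = length-<-++ [] x≢[] , x-pal , concat pre , concat post , concat-++ pre (_ ∷ post)

  ∈-decode-codes : ∀ {K n} {w : Word q} → length w ≡ n → 1 ≤ n → IsRich w →
                   ∀ fs → IsUPSFactorization fs w → length fs ≤ K → w ∈ map decode (codes K n)
  ∈-decode-codes refl () _ [] (refl , _) _
  ∈-decode-codes {K} refl _ w-rich fs@(_ ∷ _) ups@(refl , _) |fs|≤K =
    subst (_∈ map decode (codes K (length (concat fs)))) (decode-encode fs (All.map (proj₁ ∘ proj₂) pieces))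
      (∈-map⁺ decode (∈-concatMap⁺ _ (lose (∈-upTo⁺ |fs|≤K)
        (encode-∈-codesOfLength fs (All.map proj₁ pieces) (All.map half-rich pieces)))))
    where
    pieces : All (λ x → 1 ≤ length x × PalFactor x (concat fs)) fs
    pieces = All.tabulate (UPS-piece ups)
    half-rich : ∀ {x} → 1 ≤ length x × PalFactor x (concat fs) → IsRich (half x)
    half-rich {x} (_ , _ , x⊑w) = IsRich-Factor w-rich (Factor-trans (Factor-half x) x⊑w)

theorem2 : (q : ℕ) → 2 ≤ q → (κ : ℕ → ℕ)
    → (∀ n → 2 ≤ n → (w : Word q) → length w ≡ n → IsRich w
         → (fs : List (Word q)) → IsUPSFactorization fs w → length fs ≤ κ n)
    → ∀ n → 2 ≤ n → R q n ≤ outerSum q (κ n) n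
theorem2 q _ κ ups-bound n 2≤n = begin
    R q n                               ≤⟨ Unique-⊆⇒length≤ (Unique.filter⁺ isRich? (allWords-Unique n)) richWords⊆ ⟩
    length (map decode (codes (κ n) n)) ≡⟨ length-map decode (codes (κ n) n) ⟩
    length (codes (κ n) n)              ≡⟨ length-codes (κ n) n ⟩
    outerSum q (κ n) n                  ∎
  where
  open ≤-Reasoning
  richWords⊆ : richWords n ⊆ map decode (codes (κ n) n)
  richWords⊆ {w} w∈ =
    let w∈allWords , w-rich = ∈-filter⁻ isRich? {xs = allWords q n} w∈
        |w|≡n = ∈-allWords⇒length n w∈allWords
        fs , fs-ups = upsFactorization w
    in ∈-decode-codes |w|≡n (≤-trans (s≤s z≤n) 2≤n) w-rich fs fs-ups
         (ups-bound n 2≤n w |w|≡n w-rich fs fs-ups)
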